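{- (1) The standardization map $\mathrm{std}:\mathcal{C}_{n,\mu}\rightarrow S_n$ is injective and is a morphism of graphs from $\mathrm{Cay}(\mathcal{C}_{n,\mu})$ to $\mathrm{Cay}(S_n)$. (2) The map $\mathrm{STD}$, defined by $\mathrm{STD}(T_{\varepsilon_\mu})=T$, is injective and is a morphism of graphs from $\mathcal{SF}_n(\varepsilon_\mu)$ to $\mathcal{F}_n$.
   Context: A map $f$ from the vertices of a graph $G$ to those of a graph $H$ is a morphism of graphs if for every edge $\{a,b\}$ of $G$, either $f(a)=f(b)$ or $\{f(a),f(b)\}$ is an edge of $H$. $\mathcal{C}=\{c_1<\dots<c_p\}$ is a totally ordered set of colors, $\mu=(\mu_1,\dots,\mu_p)\in\mathbb{N}^p$ with $\sum\mu_k=n$, and $\mathcal{C}_{n,\mu}$ is the set of words of length $n$ on $\mathcal{C}$ with $\mu_k$ occurrences of $c_k$. $\mathrm{Cay}(\mathcal{C}_{n,\mu})$ is the graph on $\mathcal{C}_{n,\mu}$ in which $w,w'$ are adjacent iff $w'\neq w$ is obtained by exchanging two consecutive letters of $w$; $\mathrm{Cay}(S_n)$ is defined likewise on permutations of $X=\{x_1<\dots<x_n\}$ (words using each letter of $X$ once). $\mathrm{std}(w)$ replaces the occurrences of $c_1$ in $w$, read left to right, by $x_1,\dots,x_{\mu_1}$, then those of $c_2$ by $x_{\mu_1+1},\dots,x_{\mu_1+\mu_2}$, etc. $P$ is a convex $(n+2)$-gon with vertices labelled $0<x_1<\dots<x_n<\infty$ clockwise; each face of a triangulation is labelled by its middle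 vertex. $\varepsilon_\mu\in\mathcal{C}^n$ consists of $\mu_1$ copies of $c_1$, then $\mu_2$ copies of $c_2$, etc.; the colored triangulation $T_{\varepsilon_\mu}$ is the triangulation $T$ with vertex $x_i$ and the face labelled $x_i$ colored by the $i$-th entry of $\varepsilon_\mu$. $T_{\varepsilon_\mu}$ is simple if no diagonal of $T$ joins two vertices of the same color and, whenever $x_i,x_{i+1}$ have the same color, the third vertex $t_i$ of the face containing the side $\{x_i,x_{i+1}\}$ satisfies $t_i<x_i$. $\mathcal{SF}_n(\varepsilon_\mu)$ is the graph whose vertices are the simple colored triangulations with coloring $\varepsilon_\mu$, two being adjacent iff they differ by a switched flip, i.e. a diagonal flip (replacing a diagonal $d$ by the other diagonal of the quadrilateral formed by the two faces adjacent to $d$) such that the two faces adjacent to $d$ have different colors, vertex colors being kept. $\mathcal{F}_n$ is the flip graph on triangulations of $P$ (adjacent iff differing by one diagonal flip). -}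

module Defs where

open import Data.Nat using (ℕ; zero; suc; _+_; _<_; _≤_; _⊓_; _⊔_; _<ᵇ_)
open import Data.Fin using (Fin; toℕ; _≟_)
open import Data.Bool using (Bool; true; false; if_then_else_)
open import Data.List as L using (List)
open import Data.Vec as V using (Vec; []; _∷_)
open import Data.Nat.ListAction using (sum)
open import Data.Maybe using (Maybe; just; nothing)
open import Data.Product using (_×_; _,_; ∃; ∃-syntax; proj₁; proj₂)
open import Data.Sum using (_⊎_)
open import Relation.Nullary using (¬_; yes; no)
open import Relation.Binary.PropositionalEquality using (_≡_; _≢_)

-- The letters x_1 < ... < x_n of X are represented by the naturals
-- 0 < 1 < ... < n-1 (x_i ↦ i-1).

occ : ∀ {p m} → Fin p → Vec (Fin p) m → ℕ
occ c []      = 0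
occ c (d ∷ w) with c ≟ d
... | yes _ = suc (occ c w)
... | no  _ = occ c w

InC : ∀ {p n} → Vec ℕ p → Vec (Fin p) n → Set
InC μ w = ∀ c → occ c w ≡ V.lookup μ c

occℕ : ∀ {m} → ℕ → Vec ℕ m → ℕ
occℕ k []      = 0
occℕ k (d ∷ w) with k Data.Nat.≟ d
... | yes _ = suc (occℕ k w)
... | no  _ = occℕ k w

IsPerm : (n : ℕ) → Vec ℕ n → Set
IsPerm n σ = (∀ i → V.lookup σ i < n) × (∀ k → k < n → occℕ k σ ≡ 1)

offset : ∀ {p} → Vec ℕ p → Fin p → ℕ
offset μ c = sum (L.take (toℕ c) (V.toList μ))

-- stdAux cnt w: cnt d = number of occurrences of d already read
stdAux : ∀ {p m} → Vec ℕ p → (Fin p → ℕ) → Vec (Fin p) m → Vec ℕ m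
stdAux μ cnt []      = []
stdAux μ cnt (c ∷ w) =
  (offset μ c + cnt c) ∷ stdAux μ (λ d → if ⌊ d ≟ c ⌋' then suc (cnt d) else cnt d) w
  where
  ⌊_⌋' : ∀ {P : Set} → Relation.Nullary.Dec P → Bool
  ⌊ yes _ ⌋' = true
  ⌊ no  _ ⌋' = false

-- standardization: the j-th occurrence (from the left, j ≥ 1) of c_k is
-- replaced by x_{μ_1+...+μ_{k-1}+j}, i.e. by the natural μ_1+...+μ_{k-1}+j-1
std : ∀ {p m} → Vec ℕ p → Vec (Fin p) m → Vec ℕ m
std μ w = stdAux μ (λ _ → 0) w

swapAt : ∀ {A : Set} {m} → ℕ → Vec A m → Vec A m
swapAt zero    (a ∷ b ∷ w) = b ∷ a ∷ w
swapAt (suc i) (a ∷ w)     = a ∷ swapAt i w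
swapAt _       w           = w

CayAdj : ∀ {A : Set} {m} → Vec A m → Vec A m → Set
CayAdj {m = m} w w' = w' ≢ w × ∃[ i ] (suc i < m × w' ≡ swapAt i w)

-- Part (2): triangulations of the (n+2)-gon
-- Vertices of P: 0 ↦ 0, x_i ↦ i (1 ≤ i ≤ n), ∞ ↦ n+1.
-- A set of diagonals is an (n+2)×(n+2) Boolean matrix; entry (x,y) = true
-- means the diagonal {x,y} (x<y) is present.

Mat : ℕ → Set
Mat n = Vec (Vec Bool (suc (suc n))) (suc (suc n))

getB : ∀ {m} → Vec Bool m → ℕ → Bool
getB []      _       = false
getB (b ∷ v) zero    = b
getB (_ ∷ v) (suc k) = getB v k

edge : ∀ {n} → Mat n → ℕ → ℕ → Bool
edge {n} T x y = go T x
  where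
  go : ∀ {k} → Vec (Vec Bool (suc (suc n))) k → ℕ → Bool
  go []      _       = false
  go (r ∷ R) zero    = getB r y
  go (r ∷ R) (suc i) = go R i

IsDiagPos : ℕ → ℕ → ℕ → Set
IsDiagPos n x y = (suc (suc x) ≤ y) × (y ≤ suc n) × ¬ (x ≡ 0 × y ≡ suc n)

Cross : ℕ → ℕ → ℕ → ℕ → Set
Cross a b c d = (a < c × c < b × b < d) ⊎ (c < a × a < d × d < b)

IsTri : (n : ℕ) → Mat n → Set
IsTri n T =
  (∀ x y → edge T x y ≡ true → IsDiagPos n x y) ×
  (∀ a b c d → edge T a b ≡ true → edge T c d ≡ true → ¬ Cross a b c d) ×
  (∀ a b → IsDiagPos n a b → edge T a b ≡ false →
     ∃[ c ] ∃[ d ] (edge T c d ≡ true × Cross a b c d))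

Side : ∀ {n} → Mat n → ℕ → ℕ → Set
Side {n} T x y = (suc x ≡ y) ⊎ (x ≡ 0 × y ≡ suc n) ⊎ (edge T x y ≡ true)

Triple : Set
Triple = ℕ × ℕ × ℕ

IsFace : ∀ {n} → Mat n → Triple → Set
IsFace {n} T (i , j , k) =
  i < j × j < k × k ≤ suc n × Side T i j × Side T j k × Side T i k

-- the sorted triple {a,c,b}, assuming a < c
face3 : ℕ → ℕ → ℕ → Triple
face3 a c b = if b <ᵇ a then (b , a , c) else (if b <ᵇ c then (a , b , c) else (a , c , b))

label : Triple → ℕ
label (_ , j , _) = j

-- T' is obtained from T by flipping the diagonal {a,c}: the two faces adjacent
-- to {a,c} are {a,c,b} and {a,c,e} (b ≠ e), and {a,c} is replaced by {b,e}.
FlipAt : ∀ {n} → Mat n → Mat n → ℕ → ℕ → ℕ → ℕ → Set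
FlipAt T T' a c b e =
  edge T a c ≡ true × IsFace T (face3 a c b) × IsFace T (face3 a c e) × b ≢ e ×
  (∀ x y → (edge T' x y ≡ true →
              (edge T x y ≡ true × ¬ (x ≡ a × y ≡ c)) ⊎ (x ≡ b ⊓ e × y ≡ b ⊔ e)) ×
           ((edge T x y ≡ true × ¬ (x ≡ a × y ≡ c)) ⊎ (x ≡ b ⊓ e × y ≡ b ⊔ e) →
              edge T' x y ≡ true))

Flip : ∀ {n} → Mat n → Mat n → Set
Flip T T' = ∃[ a ] ∃[ c ] ∃[ b ] ∃[ e ] FlipAt T T' a c b e

epsμ : ∀ {p} → Vec ℕ p → List (Fin p)
epsμ μ = L.concat (L.map (λ c → L.replicate (V.lookup μ c) c) (L.allFin _))

lookupL : ∀ {A : Set} → List A → ℕ → Maybe A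
lookupL L.[]       _       = nothing
lookupL (a L.∷ as) zero    = just a
lookupL (a L.∷ as) (suc k) = lookupL as k

-- color of a polygon vertex under coloring ε (vertex x_i gets the i-th entry;
-- 0 and ∞ are uncolored)
colV : ∀ {p} → List (Fin p) → ℕ → Maybe (Fin p)
colV ε zero    = nothing
colV ε (suc i) = lookupL ε i

SameCol : ∀ {p} → List (Fin p) → ℕ → ℕ → Set
SameCol ε x y = ∃[ c ] (colV ε x ≡ just c × colV ε y ≡ just c)

-- a colored triangulation: a triangulation with a coloring of x_1..x_n
-- (the face labelled x_i gets the color of x_i)
ColTri : ℕ → ℕ → Set
ColTri n p = Mat n × List (Fin p)

colF : ∀ {p} → List (Fin p) → Triple → Maybe (Fin p)
colF ε f = colV ε (label f)

Simple : ∀ {n p} → ColTri n p → Set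
Simple {n} (T , ε) =
  (∀ x y → edge T x y ≡ true → ¬ SameCol ε x y) ×
  (∀ i → 1 ≤ i → i < n → SameCol ε i (suc i) →
     ∀ t → IsFace T (face3 i (suc i) t) → t < i)

InSF : ∀ {n p} → Vec ℕ p → ColTri n p → Set
InSF {n} μ (T , ε) = IsTri n T × ε ≡ epsμ μ × Simple (T , ε)

SwitchedFlip : ∀ {n p} → ColTri n p → ColTri n p → Set
SwitchedFlip (T , ε) (T' , ε') =
  ε' ≡ ε ×
  ∃[ a ] ∃[ c ] ∃[ b ] ∃[ e ]
    (FlipAt T T' a c b e × colF ε (face3 a c b) ≢ colF ε (face3 a c e))

STD : ∀ {n p} → ColTri n p → Mat n
STD = proj₁

{-# OPTIONS --safe #-}
-- Reading a word from left to right with one counter per colour, std sends the letter c read after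
-- cnt c earlier occurrences of c to offset μ c + cnt c. The blocks [offset μ c, offset μ c + μ_c)
-- partition [0, sum μ), so on a word of content μ every value of [0, n) is hit exactly once: std w is
-- a permutation, and since its first value determines the first colour of w, std is injective.
-- Exchanging two different adjacent colours only reorders two counter increments, which commute, so
-- std commutes with the exchange, and injectivity rules out a loop. In (2) the colouring is forced to
-- be ε_μ, so forgetting it is injective, and a switched flip is in particular a flip.
module Submission where

open import Defs
open import Data.Nat using (ℕ; zero; suc; _+_; _≤_; _<_; z≤n; _<?_)
  renaming (_≟_ to _≟ℕ_)
open import Data.Nat.Properties
  using (+-assoc; +-suc; +-identityʳ; +-cancelˡ-≡; +-cancelˡ-<; +-monoʳ-<; m≤m+n;
         m+n≤o⇒m≤o; m+[n∸m]≡n; ≮⇒≥; ≤-reflexive; <⇒≱; <-≤-trans; ≤-trans; ≤∧≢⇒<;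
         <-irrefl; n≤1+n; ≤-refl)
open import Data.Fin using (Fin; zero; suc; _≟_)
open import Data.Vec using (Vec; []; _∷_; lookup; sum)
open import Data.Vec.Properties using (∷-injective)
open import Data.Product using (_×_; _,_; proj₁; Σ-syntax; ∃-syntax)
open import Data.Sum using (_⊎_; inj₂)
open import Function using (_∘_)
open import Data.Bool using (if_then_else_)
open import Relation.Nullary using (yes; no; does; contradiction)
open import Relation.Binary.PropositionalEquality
  using (_≡_; _≢_; _≗_; refl; sym; trans; cong; cong₂; subst; module ≡-Reasoning)

private
  variable
    p m n j k : ℕ
    cnt cnt′ : Fin p → ℕ
    c : Fin p
    w : Vec (Fin p) m

offset+<sum : ∀ (μ : Vec ℕ p) c → j < lookup μ c → offset μ c + j < sum μ
offset+<sum (m ∷ μ) zero    j<m = <-≤-trans j<m (m≤m+n m (sum μ))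
offset+<sum {j = j} (m ∷ μ) (suc c) j<μc =
  subst (_< m + sum μ) (sym (+-assoc m (offset μ c) j)) (+-monoʳ-< m (offset+<sum μ c j<μc))

m<n⇒m≢n+o+p : ∀ {m n} o p → m < n → m ≢ n + o + p
m<n⇒m≢n+o+p {n = n} o p m<n refl = <⇒≱ m<n (≤-trans (m≤m+n n o) (m≤m+n (n + o) p))

offset+-injectiveˡ : ∀ (μ : Vec ℕ p) c d → j < lookup μ c → k < lookup μ d →
                     offset μ c + j ≡ offset μ d + k → c ≡ d
offset+-injectiveˡ (m ∷ μ) zero    zero    _   _   _  = refl
offset+-injectiveˡ (m ∷ μ) zero    (suc d) j<m _   eq = contradiction eq (m<n⇒m≢n+o+p _ _ j<m)
offset+-injectiveˡ (m ∷ μ) (suc c) zero    _   k<m eq = contradiction (sym eq) (m<n⇒m≢n+o+p _ _ k<m)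
offset+-injectiveˡ {j = j} {k} (m ∷ μ) (suc c) (suc d) j<μc k<μd eq =
  cong suc (offset+-injectiveˡ μ c d j<μc k<μd
    (+-cancelˡ-≡ m _ _ (trans (sym (+-assoc m _ j)) (trans eq (+-assoc m _ k)))))

offset+-injective : ∀ (μ : Vec ℕ p) c d → j < lookup μ c → k < lookup μ d →
                    offset μ c + j ≡ offset μ d + k → c ≡ d × j ≡ k
offset+-injective μ c d j<μc k<μd eq with offset+-injectiveˡ μ c d j<μc k<μd eq
... | refl = refl , +-cancelˡ-≡ (offset μ c) _ _ eq

offset+-surjective : ∀ (μ : Vec ℕ p) → k < sum μ →
                     ∃[ c ] ∃[ j ] (j < lookup μ c × offset μ c + j ≡ k)
offset+-surjective {k = k} (m ∷ μ) k<sum with k <? m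
... | yes k<m = zero , k , k<m , refl
... | no  k≮m =
  let m+[k∸m]≡k = m+[n∸m]≡n (≮⇒≥ k≮m)
      c , j , j<μc , eq = offset+-surjective μ
        (+-cancelˡ-< m _ _ (subst (_< m + sum μ) (sym m+[k∸m]≡k) k<sum))
  in suc c , j , j<μc , trans (+-assoc m _ j) (trans (cong (m +_) eq) m+[k∸m]≡k)

bump : Fin p → (Fin p → ℕ) → Fin p → ℕ
bump c cnt d = if does (d ≟ c) then suc (cnt d) else cnt d

bump-self : ∀ c (cnt : Fin p → ℕ) → bump c cnt c ≡ suc (cnt c)
bump-self c cnt with c ≟ c
... | yes _   = refl
... | no  c≢c = contradiction refl c≢c

bump-other : ∀ {c} (cnt : Fin p → ℕ) {d} → d ≢ c → bump c cnt d ≡ cnt d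
bump-other {c = c} cnt {d} d≢c with d ≟ c
... | yes d≡c = contradiction d≡c d≢c
... | no  _   = refl

bump-cong : ∀ c → cnt ≗ cnt′ → bump c cnt ≗ bump c cnt′
bump-cong c eq d with d ≟ c
... | yes _ = cong suc (eq d)
... | no  _ = eq d

bump+occ : ∀ c (cnt : Fin p → ℕ) d (w : Vec (Fin p) m) →
           bump c cnt d + occ d w ≡ cnt d + occ d (c ∷ w)
bump+occ c cnt d w with d ≟ c
... | yes _ = sym (+-suc (cnt d) (occ d w))
... | no  _ = refl

bump-≥ : ∀ c (cnt : Fin p → ℕ) d → cnt d ≤ bump c cnt d
bump-≥ c cnt d with d ≟ c
... | yes _ = n≤1+n (cnt d)
... | no  _ = ≤-refl

bump-comm : ∀ a b (cnt : Fin p → ℕ) → bump a (bump b cnt) ≗ bump b (bump a cnt)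
bump-comm a b cnt d with d ≟ a | d ≟ b
... | yes _ | yes _ = refl
... | yes _ | no  _ = refl
... | no  _ | yes _ = refl
... | no  _ | no  _ = refl

occℕ-∷≡1 : ∀ k l (v : Vec ℕ m) →
           (k ≡ l → occℕ k v ≡ 0) → (k ≢ l → occℕ k v ≡ 1) → occℕ k (l ∷ v) ≡ 1
occℕ-∷≡1 k l v at-head later with k ≟ℕ l
... | yes k≡l = cong suc (at-head k≡l)
... | no  k≢l = later k≢l

occℕ-∷≡0 : ∀ k l (v : Vec ℕ m) → k ≢ l → occℕ k v ≡ 0 → occℕ k (l ∷ v) ≡ 0
occℕ-∷≡0 k l v k≢l absent with k ≟ℕ l
... | yes k≡l = contradiction k≡l k≢l
... | no  _   = absent

module _ (μ : Vec ℕ p) where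

  -- stdAux updates its counter through a helper local to Defs, so the update is named by unification.
  private
    stdAux-step : ∀ cnt c (w : Vec (Fin p) m) →
      Σ[ cnt′ ∈ (Fin p → ℕ) ] stdAux μ cnt (c ∷ w) ≡ (offset μ c + cnt c) ∷ stdAux μ cnt′ w
    stdAux-step cnt c w = _ , refl

    stdAux-step≗bump : ∀ cnt c (w : Vec (Fin p) m) →
                       proj₁ (stdAux-step cnt c w) ≗ bump c cnt
    stdAux-step≗bump cnt c w d with d ≟ c
    ... | yes _ = refl
    ... | no  _ = refl

  stdAux-cong : ∀ (w : Vec (Fin p) m) → cnt ≗ cnt′ → stdAux μ cnt w ≡ stdAux μ cnt′ w
  stdAux-cong []      eq = refl
  stdAux-cong {cnt = cnt} {cnt′} (c ∷ w) eq =
    cong₂ _∷_ (cong (offset μ c +_) (eq c)) (stdAux-cong w step≗)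
    where
    step≗ : proj₁ (stdAux-step cnt c w) ≗ proj₁ (stdAux-step cnt′ c w)
    step≗ d = trans (stdAux-step≗bump cnt c w d)
                (trans (bump-cong c eq d) (sym (stdAux-step≗bump cnt′ c w d)))

  stdAux-∷ : ∀ cnt c (w : Vec (Fin p) m) →
             stdAux μ cnt (c ∷ w) ≡ (offset μ c + cnt c) ∷ stdAux μ (bump c cnt) w
  stdAux-∷ cnt c w = cong (_ ∷_) (stdAux-cong w (stdAux-step≗bump cnt c w))

  record Fits (cnt : Fin p → ℕ) (w : Vec (Fin p) m) : Set where
    constructor fits
    field budget : ∀ d → cnt d + occ d w ≤ lookup μ d
  open Fits

  InC⇒Fits : ∀ (w : Vec (Fin p) m) → InC μ w → Fits (λ _ → 0) w
  InC⇒Fits w inC = fits (≤-reflexive ∘ inC)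

  Fits-tail : Fits cnt (c ∷ w) → Fits (bump c cnt) w
  Fits-tail {cnt = cnt} {c = c} {w = w} f =
    fits λ d → subst (_≤ lookup μ d) (sym (bump+occ c cnt d w)) (budget f d)

  Fits-head : Fits cnt (c ∷ w) → cnt c < lookup μ c
  Fits-head {cnt = cnt} {c = c} {w = w} f =
    m+n≤o⇒m≤o (suc (cnt c))
      (subst (λ x → x + occ c w ≤ lookup μ c) (bump-self c cnt) (budget (Fits-tail f) c))

  stdAux-< : ∀ cnt (w : Vec (Fin p) m) → Fits cnt w → ∀ i → lookup (stdAux μ cnt w) i < sum μ
  stdAux-< cnt (c ∷ w) fit zero    = offset+<sum μ c (Fits-head fit)
  stdAux-< cnt (c ∷ w) fit (suc i) =
    subst (λ v → lookup v (suc i) < sum μ) (sym (stdAux-∷ cnt c w))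
          (stdAux-< (bump c cnt) w (Fits-tail fit) i)

  occℕ-stdAux≡0 : ∀ cnt (w : Vec (Fin p) m) c → Fits cnt w →
                  j < cnt c → occℕ (offset μ c + j) (stdAux μ cnt w) ≡ 0
  occℕ-stdAux≡0 cnt []      c fit j<cnt = refl
  occℕ-stdAux≡0 {j = j} cnt (d ∷ w) c fit j<cnt =
    trans (cong (occℕ (offset μ c + j)) (stdAux-∷ cnt d w))
      (occℕ-∷≡0 _ _ _ not-head
        (occℕ-stdAux≡0 (bump d cnt) w c (Fits-tail fit) (<-≤-trans j<cnt (bump-≥ d cnt c))))
    where
    not-head : offset μ c + j ≢ offset μ d + cnt d
    not-head eq with offset+-injective μ c d (<-≤-trans j<cnt (m+n≤o⇒m≤o (cnt c) (budget fit c)))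
                                             (Fits-head fit) eq
    ... | refl , refl = <-irrefl refl j<cnt

  occℕ-stdAux≡1 : ∀ cnt (w : Vec (Fin p) m) c → Fits cnt w → cnt c ≤ j → j < cnt c + occ c w →
                  occℕ (offset μ c + j) (stdAux μ cnt w) ≡ 1
  occℕ-stdAux≡1 {j = j} cnt [] c fit lo hi =
    contradiction lo (<⇒≱ (subst (j <_) (+-identityʳ (cnt c)) hi))
  occℕ-stdAux≡1 {j = j} cnt (d ∷ w) c fit lo hi =
    trans (cong (occℕ (offset μ c + j)) (stdAux-∷ cnt d w)) (occℕ-∷≡1 _ _ _ at-head later)
    where
    at-head : offset μ c + j ≡ offset μ d + cnt d →
              occℕ (offset μ c + j) (stdAux μ (bump d cnt) w) ≡ 0
    at-head eq with offset+-injective μ c d (<-≤-trans hi (budget fit c)) (Fits-head fit) eq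
    ... | refl , refl =
      occℕ-stdAux≡0 (bump c cnt) w c (Fits-tail fit) (≤-reflexive (sym (bump-self c cnt)))

    later : offset μ c + j ≢ offset μ d + cnt d →
            occℕ (offset μ c + j) (stdAux μ (bump d cnt) w) ≡ 1
    later ne =
      occℕ-stdAux≡1 (bump d cnt) w c (Fits-tail fit) lo′ (subst (j <_) (sym (bump+occ d cnt c w)) hi)
      where
      lo′ : bump d cnt c ≤ j
      lo′ with c ≟ d
      ... | yes refl = ≤∧≢⇒< lo (ne ∘ cong (offset μ c +_) ∘ sym)
      ... | no _     = lo

  stdAux-injective : ∀ cnt (w w′ : Vec (Fin p) m) → Fits cnt w → Fits cnt w′ →
                     stdAux μ cnt w ≡ stdAux μ cnt w′ → w ≡ w′
  stdAux-injective cnt []      []        _    _     _  = refl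
  stdAux-injective cnt (c ∷ w) (c′ ∷ w′) fit fit′ eq
    with ∷-injective (trans (sym (stdAux-∷ cnt c w)) (trans eq (stdAux-∷ cnt c′ w′)))
  ... | heads , tails with offset+-injective μ c c′ (Fits-head fit) (Fits-head fit′) heads
  ...   | refl , _ =
    cong (c ∷_) (stdAux-injective (bump c cnt) w w′ (Fits-tail fit) (Fits-tail fit′) tails)

  stdAux-swap₀ : ∀ cnt {a b} (r : Vec (Fin p) m) → a ≢ b →
                 stdAux μ cnt (b ∷ a ∷ r) ≡ swapAt 0 (stdAux μ cnt (a ∷ b ∷ r))
  stdAux-swap₀ cnt {a} {b} r a≢b = begin
    stdAux μ cnt (b ∷ a ∷ r)
      ≡⟨ stdAux-∷∷ b a ⟩
    (offset μ b + cnt b) ∷ (offset μ a + bump b cnt a) ∷ stdAux μ (bump a (bump b cnt)) r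
      ≡⟨ cong₂ _∷_ (cong (offset μ b +_) (sym (bump-other cnt (a≢b ∘ sym))))
                   (cong₂ _∷_ (cong (offset μ a +_) (bump-other cnt a≢b))
                              (stdAux-cong r (bump-comm a b cnt))) ⟩
    (offset μ b + bump a cnt b) ∷ (offset μ a + cnt a) ∷ stdAux μ (bump b (bump a cnt)) r
      ≡⟨ cong (swapAt 0) (sym (stdAux-∷∷ a b)) ⟩
    swapAt 0 (stdAux μ cnt (a ∷ b ∷ r)) ∎
    where
    open ≡-Reasoning
    stdAux-∷∷ : ∀ x y → stdAux μ cnt (x ∷ y ∷ r) ≡
                (offset μ x + cnt x) ∷ (offset μ y + bump x cnt y) ∷ stdAux μ (bump y (bump x cnt)) r
    stdAux-∷∷ x y =
      trans (stdAux-∷ cnt x (y ∷ r)) (cong (offset μ x + cnt x ∷_) (stdAux-∷ (bump x cnt) y r))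

  stdAux-swapAt : ∀ cnt i (w : Vec (Fin p) m) → swapAt i w ≢ w →
                  stdAux μ cnt (swapAt i w) ≡ swapAt i (stdAux μ cnt w)
  stdAux-swapAt cnt zero    []          moved = contradiction refl moved
  stdAux-swapAt cnt zero    (a ∷ [])    moved = contradiction refl moved
  stdAux-swapAt cnt zero    (a ∷ b ∷ r) moved = stdAux-swap₀ cnt r a≢b
    where
    a≢b : a ≢ b
    a≢b refl = moved refl
  stdAux-swapAt cnt (suc i) []          moved = contradiction refl moved
  stdAux-swapAt cnt (suc i) (a ∷ r)     moved = begin
    stdAux μ cnt (a ∷ swapAt i r)
      ≡⟨ stdAux-∷ cnt a (swapAt i r) ⟩
    (offset μ a + cnt a) ∷ stdAux μ (bump a cnt) (swapAt i r)
      ≡⟨ cong (_ ∷_) (stdAux-swapAt (bump a cnt) i r (moved ∘ cong (a ∷_))) ⟩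
    (offset μ a + cnt a) ∷ swapAt i (stdAux μ (bump a cnt) r)
      ≡⟨ cong (swapAt (suc i)) (sym (stdAux-∷ cnt a r)) ⟩
    swapAt (suc i) (stdAux μ cnt (a ∷ r)) ∎
    where open ≡-Reasoning

  std-isPerm : sum μ ≡ n → (w : Vec (Fin p) n) → InC μ w → IsPerm n (std μ w)
  std-isPerm refl w inC = stdAux-< _ w (InC⇒Fits w inC) , once
    where
    once : ∀ k → k < sum μ → occℕ k (std μ w) ≡ 1
    once k k<sum with offset+-surjective μ k<sum
    ... | c , j , j<μc , refl =
      occℕ-stdAux≡1 _ w c (InC⇒Fits w inC) z≤n (subst (j <_) (sym (inC c)) j<μc)

  std-injective : ∀ (w w′ : Vec (Fin p) m) → InC μ w → InC μ w′ → std μ w ≡ std μ w′ → w ≡ w′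
  std-injective w w′ inC inC′ = stdAux-injective _ w w′ (InC⇒Fits w inC) (InC⇒Fits w′ inC′)

  std-CayAdj : ∀ (w w′ : Vec (Fin p) m) → InC μ w → InC μ w′ →
               CayAdj w w′ → CayAdj (std μ w) (std μ w′)
  std-CayAdj w _ inC inC′ (moved , i , i+1<m , refl) =
    moved ∘ std-injective _ w inC′ inC , i , i+1<m , stdAux-swapAt _ i w moved

STD-injective : ∀ (μ : Vec ℕ p) {X Y : ColTri n p} →
                InSF μ X → InSF μ Y → STD X ≡ STD Y → X ≡ Y
STD-injective μ (_ , ε≡εμ , _) (_ , ε′≡εμ , _) T≡T′ =
  cong₂ _,_ T≡T′ (trans ε≡εμ (sym ε′≡εμ))

SwitchedFlip⇒Flip : ∀ (X Y : ColTri n p) → SwitchedFlip X Y → Flip (STD X) (STD Y)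
SwitchedFlip⇒Flip _ _ (_ , a , c , b , e , flip , _) = a , c , b , e , flip

mainTheorem13 : (p n : ℕ) (μ : Vec ℕ p) → sum μ ≡ n →
    ( (∀ (w : Vec (Fin p) n) → InC μ w → IsPerm n (std μ w))
    × (∀ (w w' : Vec (Fin p) n) → InC μ w → InC μ w' → std μ w ≡ std μ w' → w ≡ w')
    × (∀ (w w' : Vec (Fin p) n) → InC μ w → InC μ w' → CayAdj w w' →
         std μ w ≡ std μ w' ⊎ CayAdj (std μ w) (std μ w')) )
    ×
    ( (∀ (X : ColTri n p) → InSF μ X → IsTri n (STD X))
    × (∀ (X Y : ColTri n p) → InSF μ X → InSF μ Y → STD X ≡ STD Y → X ≡ Y)
    × (∀ (X Y : ColTri n p) → InSF μ X → InSF μ Y → SwitchedFlip X Y →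
         STD X ≡ STD Y ⊎ Flip (STD X) (STD Y)) )
mainTheorem13 p n μ sum≡n =
  ( std-isPerm μ sum≡n
  , std-injective μ
  , (λ w w′ inC inC′ → inj₂ ∘ std-CayAdj μ w w′ inC inC′) )
  ,
  ( (λ _ → proj₁)
  , (λ _ _ → STD-injective μ)
  , (λ X Y _ _ → inj₂ ∘ SwitchedFlip⇒Flip X Y) )
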